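{- Let $C$ and $n$ be positive integers and let $\mathsf{EDP}(C,n)$ be the CNF formula defined in the context. For any assignment $I:\{p_1,\dots,p_n\}\to\{0,1\}$ the following are equivalent: (a) there is an assignment $I'$ to $\{p_1,\dots,p_n\}$ together with all propositions occurring in $\mathsf{EDP}(C,n)$, agreeing with $I$ on $p_1,\dots,p_n$, that satisfies $\mathsf{EDP}(C,n)$; (b) the $\pm1$ sequence $x_1,\dots,x_n$ given by $x_i=2I(p_i)-1$ has discrepancy at most $C$.
   Context: The discrepancy of a finite $\pm1$ sequence $x_1,\dots,x_n$ is $\max\{|\sum_{i=1}^k x_{i\cdot d}| : d,k\ge 1,\ kd\le n\}$. For a list of propositional variables $q_1,\dots,q_m$ and fresh auxiliary variables $s^k_j$ ($0\le k,j\le m$), let $S$ be the set of clauses consisting of: for all $1\le k\le m$, $1\le j\le m$, the four clauses $(\lnot s^k_j\lor s^k_{j-1}\lor s^{k-1}_{j-1})$, $(\lnot s^k_j\lor s^k_{j-1}\lor q_j)$, $(\lnot s^k_{j-1}\lor s^k_j)$, $(\lnot s^{k-1}_{j-1}\lor\lnot q_j\lor s^k_j)$; the unit clauses $(\lnot s^k_j)$ for $0\le j<k\le m$; $(s^0_j)$ for $0\le j\le m$; $(s^k_j)$ for $1\le k\le m$, $2k-2+C<j\le m$; and $(\lnot s^k_j)$ for $1\le k\le m$, $0\le j<2k-C$. Let $\mathsf{CBound}^C(q_1,\dots,q_m)$ be the clause set obtained from $S$ by exhaustive unit propagation (repeatedly, for a unit clause $(l)$, fix $l$ to true: delete all clauses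 containing $l$ and delete $\lnot l$ from the remaining clauses). Define $\mathsf{EDP}(C,n)=\bigwedge_{d=1}^{\lfloor n/(C+1)\rfloor}\mathsf{CBound}^C(p_d,p_{2d},\dots,p_{\lfloor n/d\rfloor\cdot d})$, where the different conjuncts share the input variables $p_1,\dots,p_n$ but use pairwise disjoint sets of auxiliary variables. -}

module Defs where

open import Data.Nat using (ℕ; zero; suc; _+_; _*_; _∸_; _≤_; _<_; _/_; _≤ᵇ_; _<ᵇ_)
import Data.Nat as ℕ
open import Data.Bool using (Bool; true; false; if_then_else_; not; _∧_)
open import Data.Integer as ℤ using (ℤ; +_; -[1+_]; ∣_∣)
open import Data.List using (List; []; _∷_; [_]; map; concatMap; filter; length; upTo; _++_)
open import Data.List.Relation.Unary.All using (All)
open import Data.List.Relation.Unary.Any using (Any)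
open import Data.Maybe using (Maybe; just; nothing)
open import Relation.Binary.PropositionalEquality using (_≡_)
open import Relation.Nullary using (¬_; Dec; yes; no; ¬?)
open import Data.Bool.Properties using () renaming (_≟_ to _≟b_)
open import Relation.Nullary.Decidable using (⌊_⌋; _×-dec_)
open import Data.Product using (_×_; _,_)
open import Relation.Binary.PropositionalEquality using (refl; cong)

-- p i      : the input variable p_i
-- s d k j  : auxiliary variable s^k_j of the d-th conjunct CBound
--            (distinct d give pairwise disjoint sets of auxiliaries)
data Var : Set where
  p : ℕ → Var
  s : ℕ → ℕ → ℕ → Var

data Lit : Set where
  pos : Var → Lit
  neg : Var → Lit

Clause : Set
Clause = List Lit

CNF : Set
CNF = List Clause

_≟ᵥ_ : (x y : Var) → Dec (x ≡ y)
p i ≟ᵥ p i' with i ℕ.≟ i'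
... | yes refl = yes refl
... | no ne = no λ { refl → ne refl }
p _ ≟ᵥ s _ _ _ = no λ ()
s _ _ _ ≟ᵥ p _ = no λ ()
s d k j ≟ᵥ s d' k' j' with d ℕ.≟ d' | k ℕ.≟ k' | j ℕ.≟ j'
... | yes refl | yes refl | yes refl = yes refl
... | no ne | _ | _ = no λ { refl → ne refl }
... | yes _ | no ne | _ = no λ { refl → ne refl }
... | yes _ | yes _ | no ne = no λ { refl → ne refl }

_≟ₗ_ : (x y : Lit) → Dec (x ≡ y)
pos x ≟ₗ pos y with x ≟ᵥ y
... | yes refl = yes refl
... | no ne = no λ { refl → ne refl }
neg x ≟ₗ neg y with x ≟ᵥ y
... | yes refl = yes refl
... | no ne = no λ { refl → ne refl }
pos _ ≟ₗ neg _ = no λ ()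
neg _ ≟ₗ pos _ = no λ ()

complement : Lit → Lit
complement (pos x) = neg x
complement (neg x) = pos x

Assignment : Set
Assignment = Var → Bool

litVal : Assignment → Lit → Bool
litVal I (pos x) = I x
litVal I (neg x) = not (I x)

SatClause : Assignment → Clause → Set
SatClause I c = Any (λ l → litVal I l ≡ true) c

SatCNF : Assignment → CNF → Set
SatCNF I φ = All (SatClause I) φ

memberᵇ : Lit → Clause → Bool
memberᵇ l [] = false
memberᵇ l (l' ∷ c) with l ≟ₗ l'
... | yes _ = true
... | no _ = memberᵇ l c

findUnit : CNF → Maybe Lit
findUnit [] = nothing
findUnit ((l ∷ []) ∷ φ) = just l
findUnit (_ ∷ φ) = findUnit φ

assignLit : Lit → CNF → CNF
assignLit l φ =
  map (filter (λ l' → ¬? (l' ≟ₗ complement l)))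
      (filter (λ c → ¬? (memberᵇ l c ≟b true)) φ)

-- each step removes at least the chosen unit clause, so
-- (length φ) steps suffice to reach a formula with no unit clause
propagateFuel : ℕ → CNF → CNF
propagateFuel zero φ = φ
propagateFuel (suc f) φ with findUnit φ
... | nothing = φ
... | just l = propagateFuel f (assignLit l φ)

unitPropagate : CNF → CNF
unitPropagate φ = propagateFuel (length φ) φ

range : ℕ → ℕ → List ℕ
range a b = map (λ i → a + i) (upTo (suc b ∸ a))

-- Parameters: C, the conjunct index d, the length m, and the input
-- variables q : ℕ → Var (q j used for 1 ≤ j ≤ m).
-- Auxiliary s^k_j is the variable s d k j.
S : ℕ → ℕ → ℕ → (ℕ → Var) → CNF
S C d m q =
     concatMap (λ k → concatMap (λ j → mainClauses k j) (range 1 m)) (range 1 m)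
  ++ concatMap (λ k → map (λ j → [ neg (sv k j) ]) (range 0 (k ∸ 1))) (range 1 m)
       -- (¬ s^k_j) for 0 ≤ j < k ≤ m
  ++ map (λ j → [ pos (sv 0 j) ]) (range 0 m)
  ++ concatMap (λ k → map (λ j → [ pos (sv k j) ]) (range (suc (2 * k ∸ 2 + C)) m)) (range 1 m)
       -- (s^k_j) for 1 ≤ k ≤ m, 2k-2+C < j ≤ m
  ++ concatMap (λ k → map (λ j → [ neg (sv k j) ]) (filter (λ j → j ℕ.<? (2 * k ∸ C)) (range 0 m))) (range 1 m)
       -- (¬ s^k_j) for 1 ≤ k ≤ m, 0 ≤ j < 2k-C
  where
    sv : ℕ → ℕ → Var
    sv k j = s d k j
    mainClauses : ℕ → ℕ → CNF
    mainClauses k j =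
        (neg (sv k j) ∷ pos (sv k (j ∸ 1)) ∷ pos (sv (k ∸ 1) (j ∸ 1)) ∷ [])
      ∷ (neg (sv k j) ∷ pos (sv k (j ∸ 1)) ∷ pos (q j) ∷ [])
      ∷ (neg (sv k (j ∸ 1)) ∷ pos (sv k j) ∷ [])
      ∷ (neg (sv (k ∸ 1) (j ∸ 1)) ∷ neg (q j) ∷ pos (sv k j) ∷ [])
      ∷ []

CBound : ℕ → ℕ → ℕ → (ℕ → Var) → CNF
CBound C d m q = unitPropagate (S C d m q)

EDP : ℕ → ℕ → CNF
EDP C n = concatMap conj (range 1 (n / suc C))
  where
    conj : ℕ → CNF
    conj zero = []          -- never used (d ≥ 1)
    conj (suc e) = CBound C (suc e) (n / suc e) (λ j → p (j * suc e))

pm : Bool → ℤ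
pm true = + 1
pm false = -[1+ 0 ]

partialSum : (ℕ → Bool) → ℕ → ℕ → ℤ
partialSum I d zero = + 0
partialSum I d (suc k) = partialSum I d k ℤ.+ pm (I (suc k * d))

DiscrepancyAtMost : ℕ → (ℕ → Bool) → ℕ → Set
DiscrepancyAtMost n I C =
  ∀ d k → 1 ≤ d → 1 ≤ k → k * d ≤ n → ∣ partialSum I d k ∣ ≤ C

-- Unit propagation is sound, and it is complete as long as it never fixes an input variable,
-- which holds for S because every value of a single input extends to a model of S (an
-- alternating assignment has discrepancy 1 ≤ C). A model of S makes s^k_j mean "at least k of
-- q_1, …, q_j are true", and the unit clauses then say that 2·#{i ≤ j : q_i} − j lies in [−C, C]
-- for every j ≤ m. As Σ_{i≤k} x_{id} = 2·#{i ≤ k : p_{id}} − k, the conjunct for d is exactly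
-- the discrepancy bound along the progression of difference d; a progression with
-- d > n/(C+1) has at most C terms in [1, n] and needs no conjunct.

module Submission where

open import Defs
open import Data.Nat using (ℕ; _≤_)
open import Data.Bool using (Bool)
open import Data.Product using (Σ; _×_)
open import Relation.Binary.PropositionalEquality using (_≡_)
open import Function.Bundles using (_⇔_)

open import Data.Nat using (zero; suc; _+_; _*_; _∸_; _<_; _/_; NonZero; z≤n; s≤s; s≤s⁻¹; _≤?_; _<?_)
open import Data.Nat.Properties hiding (≤ᵇ⇒≤; ≤⇒≤ᵇ)
open import Data.Nat.DivMod using (m*n/n≡m; /-monoˡ-≤; m/n*n≤m)
open import Data.Bool using (true; false; not; _∨_; _∧_; if_then_else_)
open import Data.Bool.Properties
  using (not-involutive; not-injective; ∨-zeroʳ; ∨-identityʳ; ∧-zeroʳ; ∧-identityʳ)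
open import Data.Bool.Properties using () renaming (_≟_ to _≟b_)
open import Data.Integer using (∣_∣; _⊖_; -[1+_]) renaming (_+_ to _+ℤ_; +_ to +ℤ_)
open import Data.Integer.Properties using ([1+m]⊖[1+n]≡m⊖n; distribˡ-⊖-+-pos; distribˡ-⊖-+-neg)
open import Data.List using (List; []; _∷_; [_]; map; concatMap; filter; length)
open import Data.Bool.ListAction using (or)
open import Data.List.Membership.Propositional using (_∈_)
open import Data.List.Relation.Unary.All as All using (All; []; _∷_)
import Data.List.Relation.Unary.All.Properties as AllP
open import Data.List.Relation.Unary.Any as Any using (Any; here; there)
import Data.List.Relation.Unary.Any.Properties as AnyP
open import Data.Maybe using (just; nothing)
open import Data.Product using (_,_; proj₁; proj₂)
open import Data.Sum using (inj₁; inj₂)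
open import Data.Empty using (⊥-elim)
open import Function using (_∘_)
open import Function.Bundles using (mk⇔; Equivalence)
import Function.Properties.Equivalence as ⇔
open import Relation.Nullary using (yes; no; ¬?; contradiction)
open import Relation.Unary using (Decidable)
open import Relation.Binary.PropositionalEquality
  using (_≢_; refl; sym; trans; cong; cong₂; subst; module ≡-Reasoning)

open Equivalence using (to; from)

m<n∸o⇒m+o<n : ∀ m n o → m < n ∸ o → m + o < n
m<n∸o⇒m+o<n m n o m<n∸o = m≤o∸n⇒m+n≤o (suc m) o≤n m<n∸o
  where o≤n = <⇒≤ (m∸n≢0⇒n<m (m<n⇒n≢0 m<n∸o))

private
  variable
    A : Set

All-range⁺ : {P : ℕ → Set} → ∀ a b → (∀ x → a ≤ x → x ≤ b → P x) → All P (range a b)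
All-range⁺ a b h = AllP.map⁺ (AllP.applyUpTo⁺₁ (λ i → i) (suc b ∸ a) λ {i} i<1+b∸a →
  h (a + i) (m≤m+n a i) (s≤s⁻¹ (subst (_< suc b) (+-comm i a) (m<n∸o⇒m+o<n i (suc b) a i<1+b∸a))))

All-range⁻ : {P : ℕ → Set} → ∀ a b → All P (range a b) → ∀ x → a ≤ x → x ≤ b → P x
All-range⁻ {P} a b h x a≤x x≤b = subst P (m+[n∸m]≡n a≤x)
  (AllP.applyUpTo⁻ (λ i → i) (suc b ∸ a) (AllP.map⁻ h) (∸-monoˡ-< (s≤s x≤b) a≤x))

All-concatMap-range⁺ : {P : A → Set} {f : ℕ → List A} → ∀ a b →
                       (∀ x → a ≤ x → x ≤ b → All P (f x)) → All P (concatMap f (range a b))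
All-concatMap-range⁺ a b h = AllP.concat⁺ (AllP.map⁺ (All-range⁺ a b h))

All-concatMap-range⁻ : {P : A → Set} {f : ℕ → List A} → ∀ a b → All P (concatMap f (range a b)) →
                       ∀ x → a ≤ x → x ≤ b → All P (f x)
All-concatMap-range⁻ a b h = All-range⁻ a b (AllP.map⁻ (AllP.concat⁻ h))

module _ {P Q : A → Set} (P? : Decidable P) where

  All-filter⇔ : ∀ xs → All Q (filter P? xs) ⇔ All (λ x → P x → Q x) xs
  All-filter⇔ xs = mk⇔ (⇒ xs) (⇐ xs)
    where
    ⇒ : ∀ xs → All Q (filter P? xs) → All (λ x → P x → Q x) xs
    ⇒ [] [] = []
    ⇒ (x ∷ xs) h with P? x | h
    ... | yes _  | qx ∷ h′ = (λ _ → qx) ∷ ⇒ xs h′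
    ... | no ¬px | h′      = (λ px → contradiction px ¬px) ∷ ⇒ xs h′
    ⇐ : ∀ xs → All (λ x → P x → Q x) xs → All Q (filter P? xs)
    ⇐ [] [] = []
    ⇐ (x ∷ xs) (qx ∷ h) with P? x
    ... | yes px = qx px ∷ ⇐ xs h
    ... | no _   = ⇐ xs h

var : Lit → Var
var (pos x) = x
var (neg x) = x

polarity : Lit → Bool
polarity (pos _) = true
polarity (neg _) = false

update : Assignment → Var → Bool → Assignment
update J x b y with x ≟ᵥ y
... | yes _ = b
... | no _  = J y

update-≢ : ∀ J {x y} b → x ≢ y → update J x b y ≡ J y
update-≢ J {x} {y} b x≢y with x ≟ᵥ y
... | yes x≡y = contradiction x≡y x≢y
... | no _    = refl

satisfy : Lit → Assignment → Assignment
satisfy l J = update J (var l) (polarity l)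

satisfy-satisfies : ∀ l J → litVal (satisfy l J) l ≡ true
satisfy-satisfies (pos x) J with x ≟ᵥ x
... | yes _   = refl
... | no x≢x = contradiction refl x≢x
satisfy-satisfies (neg x) J with x ≟ᵥ x
... | yes _   = refl
... | no x≢x = contradiction refl x≢x

var-≢ : ∀ l x → x ≢ l → x ≢ complement l → var l ≢ var x
var-≢ (pos y) (pos _) x≢l _ refl = x≢l refl
var-≢ (pos y) (neg _) _ x≢l̄ refl = x≢l̄ refl
var-≢ (neg y) (pos _) _ x≢l̄ refl = x≢l̄ refl
var-≢ (neg y) (neg _) x≢l _ refl = x≢l refl

satisfy-preserves : ∀ l J x → x ≢ l → x ≢ complement l → litVal (satisfy l J) x ≡ litVal J x
satisfy-preserves l J (pos y) x≢l x≢l̄ = update-≢ J _ (var-≢ l (pos y) x≢l x≢l̄)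
satisfy-preserves l J (neg y) x≢l x≢l̄ = cong not (update-≢ J _ (var-≢ l (neg y) x≢l x≢l̄))

litVal-complement : ∀ M l → litVal M (complement l) ≡ not (litVal M l)
litVal-complement M (pos x) = refl
litVal-complement M (neg x) = sym (not-involutive (M x))

memberᵇ⇒∈ : ∀ l c → memberᵇ l c ≡ true → l ∈ c
memberᵇ⇒∈ l (x ∷ c) h with l ≟ₗ x
... | yes l≡x = here l≡x
... | no _    = there (memberᵇ⇒∈ l c h)

findUnit-sound : ∀ φ {l} → findUnit φ ≡ just l → (l ∷ []) ∈ φ
findUnit-sound ((x ∷ []) ∷ φ) refl = here refl
findUnit-sound ([] ∷ φ) h = there (findUnit-sound φ h)
findUnit-sound ((x ∷ y ∷ c) ∷ φ) h = there (findUnit-sound φ h)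

unit-true : ∀ {M φ l} → SatCNF M φ → (l ∷ []) ∈ φ → litVal M l ≡ true
unit-true sat u = AnyP.singleton⁻ (All.lookup sat u)

drop-false-literal : ∀ {M l} c → litVal M l ≡ false → SatClause M c →
                     SatClause M (filter (λ x → ¬? (x ≟ₗ l)) c)
drop-false-literal {M} {l} c l-false sat with AnyP.filter⁺ (λ x → ¬? (x ≟ₗ l)) sat
... | inj₁ sat′ = sat′
... | inj₂ ¬x≢l = ⊥-elim (¬x≢l λ { refl →
  contradiction (trans (sym l-false) (AnyP.lookup-result sat)) λ () })

assignLit-sound : ∀ {M l} φ → litVal M l ≡ true → SatCNF M φ → SatCNF M (assignLit l φ)
assignLit-sound {M} {l} φ l-true sat =
  AllP.map⁺ (AllP.filter⁺ _ (All.map (drop-false-literal _ l̄-false) sat))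
  where
  l̄-false : litVal M (complement l) ≡ false
  l̄-false = trans (litVal-complement M l) (cong not l-true)

propagateFuel-sound : ∀ f φ {M} → SatCNF M φ → SatCNF M (propagateFuel f φ)
propagateFuel-sound zero φ sat = sat
propagateFuel-sound (suc f) φ sat with findUnit φ in eq
... | nothing = sat
... | just l  = propagateFuel-sound f (assignLit l φ)
                  (assignLit-sound φ (unit-true sat (findUnit-sound φ eq)) sat)

satisfy-clause : ∀ {J l} c → memberᵇ l c ≢ true →
                 SatClause J (filter (λ x → ¬? (x ≟ₗ complement l)) c) → SatClause (satisfy l J) c
satisfy-clause {J} {l} (x ∷ c) l∉c sat with l ≟ₗ x
... | yes _ = contradiction refl l∉c
... | no l≢x with x ≟ₗ complement l | sat
...   | yes _   | sat′           = there (satisfy-clause c l∉c sat′)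
...   | no x≢l̄ | here x-true    = here (trans (satisfy-preserves l J x (l≢x ∘ sym) x≢l̄) x-true)
...   | no _    | there sat′     = there (satisfy-clause c l∉c sat′)

assignLit-complete : ∀ {J} l φ → SatCNF J (assignLit l φ) → SatCNF (satisfy l J) φ
assignLit-complete {J} l φ sat = go φ (AllP.map⁻ sat)
  where
  go : ∀ φ → All (SatClause J ∘ filter (λ x → ¬? (x ≟ₗ complement l)))
                 (filter (λ c → ¬? (memberᵇ l c ≟b true)) φ) →
       SatCNF (satisfy l J) φ
  go [] _ = []
  go (c ∷ φ) sat with memberᵇ l c ≟b true | sat
  ... | yes l∈c | sat′        =
    Any.map (λ { refl → satisfy-satisfies l J }) (memberᵇ⇒∈ l c l∈c) ∷ go φ sat′
  ... | no l∉c  | satc ∷ sat′ = satisfy-clause c l∉c satc ∷ go φ sat′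

-- Under this invariant, unit propagation never fixes an input variable.
InputsUnconstrained : CNF → Set
InputsUnconstrained φ = ∀ i b → Σ Assignment λ M → SatCNF M φ × M (p i) ≡ b

unit-not-input : ∀ {φ l} → InputsUnconstrained φ → (l ∷ []) ∈ φ → ∀ i → var l ≢ p i
unit-not-input {l = pos _} free u i refl with free i false
... | M , sat , Mpi≡false = contradiction (trans (sym Mpi≡false) (unit-true sat u)) λ ()
unit-not-input {l = neg _} free u i refl with free i true
... | M , sat , Mpi≡true = contradiction (subst (λ b → not b ≡ true) Mpi≡true (unit-true sat u)) λ ()

assignLit-inputsUnconstrained : ∀ {φ l} → InputsUnconstrained φ → (l ∷ []) ∈ φ →
                                InputsUnconstrained (assignLit l φ)
assignLit-inputsUnconstrained {φ} free u i b with free i b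
... | M , sat , Mpi≡b = M , assignLit-sound φ (unit-true sat u) sat , Mpi≡b

propagateFuel-complete : ∀ f φ {J} → InputsUnconstrained φ → SatCNF J (propagateFuel f φ) →
                         Σ Assignment λ J′ → SatCNF J′ φ × (∀ i → J′ (p i) ≡ J (p i))
propagateFuel-complete zero φ _ sat = _ , sat , λ _ → refl
propagateFuel-complete (suc f) φ free sat with findUnit φ in eq
... | nothing = _ , sat , λ _ → refl
... | just l with propagateFuel-complete f (assignLit l φ) (assignLit-inputsUnconstrained free u) sat
  where u = findUnit-sound φ eq
...   | J₁ , sat₁ , agree₁ =
  satisfy l J₁ , assignLit-complete l φ sat₁ ,
  λ i → trans (update-≢ J₁ _ (unit-not-input free (findUnit-sound φ eq) i)) (agree₁ i)

-- A structural variant of Data.Nat's _≤ᵇ_ (which goes through _<ᵇ_), convenient for induction.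
infix 7 _≤ᵇ_
_≤ᵇ_ : ℕ → ℕ → Bool
zero  ≤ᵇ _     = true
suc k ≤ᵇ zero  = false
suc k ≤ᵇ suc t = k ≤ᵇ t

≤ᵇ⇒≤ : ∀ k t → k ≤ᵇ t ≡ true → k ≤ t
≤ᵇ⇒≤ zero t _ = z≤n
≤ᵇ⇒≤ (suc k) (suc t) h = s≤s (≤ᵇ⇒≤ k t h)

≤⇒≤ᵇ : ∀ {k t} → k ≤ t → k ≤ᵇ t ≡ true
≤⇒≤ᵇ z≤n = refl
≤⇒≤ᵇ (s≤s k≤t) = ≤⇒≤ᵇ k≤t

>⇒≤ᵇ≡false : ∀ {k t} → t < k → k ≤ᵇ t ≡ false
>⇒≤ᵇ≡false {suc k} {zero} _ = refl
>⇒≤ᵇ≡false {suc k} {suc t} (s≤s t<k) = >⇒≤ᵇ≡false t<k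

≤ᵇ-suc : ∀ k t → k ≤ᵇ t ≡ (suc k ≤ᵇ t) ∨ (k ≤ᵇ t)
≤ᵇ-suc zero zero = refl
≤ᵇ-suc zero (suc t) = refl
≤ᵇ-suc (suc k) zero = refl
≤ᵇ-suc (suc k) (suc t) = ≤ᵇ-suc k t

≤ᵇ-step : ∀ k t b → suc k ≤ᵇ (if b then suc t else t) ≡ (suc k ≤ᵇ t) ∨ (k ≤ᵇ t ∧ b)
≤ᵇ-step k t true  = trans (≤ᵇ-suc k t) (cong (suc k ≤ᵇ t ∨_) (sym (∧-identityʳ (k ≤ᵇ t))))
≤ᵇ-step k t false =
  sym (trans (cong (suc k ≤ᵇ t ∨_) (∧-zeroʳ (k ≤ᵇ t))) (∨-identityʳ (suc k ≤ᵇ t)))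

count : (ℕ → Bool) → ℕ → ℕ
count x zero = 0
count x (suc j) = if x (suc j) then suc (count x j) else count x j

count≤ : ∀ x j → count x j ≤ j
count≤ x zero = z≤n
count≤ x (suc j) with x (suc j)
... | true  = s≤s (count≤ x j)
... | false = m≤n⇒m≤1+n (count≤ x j)

count-cong : ∀ {x y} j → (∀ {i} → 1 ≤ i → i ≤ j → x i ≡ y i) → count x j ≡ count y j
count-cong zero _ = refl
count-cong {x} {y} (suc j) x≗y rewrite x≗y (s≤s z≤n) ≤-refl
  | count-cong {x} {y} j (λ 1≤i i≤j → x≗y 1≤i (m≤n⇒m≤1+n i≤j)) = refl

Within : ℕ → ℕ → ℕ → Set
Within C a b = a ≤ b + C × b ≤ a + C

Within-suc : ∀ {C a b} → Within C a b ⇔ Within C (suc a) (suc b)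
Within-suc = mk⇔ (λ (a≤ , b≤) → s≤s a≤ , s≤s b≤) (λ (a≤ , b≤) → s≤s⁻¹ a≤ , s≤s⁻¹ b≤)

Within-mono : ∀ {C D a b} → C ≤ D → Within C a b → Within D a b
Within-mono {b = b} C≤D (a≤ , b≤) = ≤-trans a≤ (+-monoʳ-≤ b C≤D) , ≤-trans b≤ (+-monoʳ-≤ _ C≤D)

∣⊖∣≤⇔Within : ∀ a b {C} → ∣ a ⊖ b ∣ ≤ C ⇔ Within C a b
∣⊖∣≤⇔Within a zero = mk⇔ (_, z≤n) proj₁
∣⊖∣≤⇔Within zero (suc b) = mk⇔ (z≤n ,_) proj₂
∣⊖∣≤⇔Within (suc a) (suc b) rewrite [1+m]⊖[1+n]≡m⊖n a b = ⇔.trans (∣⊖∣≤⇔Within a b) Within-suc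

partialSum≡ : ∀ I d k → partialSum I d k ≡ 2 * count (I ∘ (_* d)) k ⊖ k
partialSum≡ I d zero = refl
partialSum≡ I d (suc k) with I (suc k * d)
... | true = begin
  partialSum I d k +ℤ +ℤ 1   ≡⟨ cong (_+ℤ +ℤ 1) (partialSum≡ I d k) ⟩
  2 * c ⊖ k +ℤ +ℤ 1          ≡⟨ distribˡ-⊖-+-pos 1 (2 * c) k ⟩
  2 * c + 1 ⊖ k              ≡⟨ cong (_⊖ k) (+-comm (2 * c) 1) ⟩
  suc (2 * c) ⊖ k            ≡⟨ [1+m]⊖[1+n]≡m⊖n (suc (2 * c)) k ⟨
  suc (suc (2 * c)) ⊖ suc k  ≡⟨ cong (_⊖ suc k) (*-suc 2 c) ⟨
  2 * suc c ⊖ suc k          ∎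
  where open ≡-Reasoning
        c = count (I ∘ (_* d)) k
... | false = begin
  partialSum I d k +ℤ -[1+ 0 ]  ≡⟨ cong (_+ℤ -[1+ 0 ]) (partialSum≡ I d k) ⟩
  2 * c ⊖ k +ℤ -[1+ 0 ]         ≡⟨ distribˡ-⊖-+-neg 0 (2 * c) k ⟩
  2 * c ⊖ (suc k + 0)           ≡⟨ cong (λ k′ → 2 * c ⊖ suc k′) (+-identityʳ k) ⟩
  2 * c ⊖ suc k                 ∎
  where open ≡-Reasoning
        c = count (I ∘ (_* d)) k

∣partialSum∣≤⇔Within : ∀ I d k {C} →
                       ∣ partialSum I d k ∣ ≤ C ⇔ Within C (2 * count (I ∘ (_* d)) k) k
∣partialSum∣≤⇔Within I d k rewrite partialSum≡ I d k = ∣⊖∣≤⇔Within _ k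

Balanced : ℕ → (ℕ → Bool) → ℕ → Set
Balanced C x m = ∀ {j} → j ≤ m → Within C (2 * count x j) j

short-prefix-within : ∀ x {C k} → k ≤ C → Within C (2 * count x k) k
short-prefix-within x {C} {k} k≤C =
  ≤-trans (*-monoʳ-≤ 2 (count≤ x k)) (+-monoʳ-≤ k (≤-trans (≤-reflexive (+-identityʳ k)) k≤C)) ,
  ≤-trans k≤C (m≤n+m C _)

-- The clause set S as a sequential counter

record SequentialCounter (C d m : ℕ) (q : ℕ → Var) (J : Assignment) : Set where
  field
    recurrence     : ∀ {k j} → suc k ≤ m → suc j ≤ m →
                     J (s d (suc k) (suc j)) ≡ J (s d (suc k) j) ∨ (J (s d k j) ∧ J (q (suc j)))
    below-diagonal : ∀ {k j} → suc k ≤ m → j ≤ k → J (s d (suc k) j) ≡ false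
    row-zero       : ∀ {j} → j ≤ m → J (s d 0 j) ≡ true
    forced-true    : ∀ {k j} → suc k ≤ m → 2 * k + C < j → j ≤ m → J (s d (suc k) j) ≡ true
    forced-false   : ∀ {k j} → k ≤ m → j ≤ m → j + C < 2 * k → J (s d k j) ≡ false

  counts : ∀ {k j} → k ≤ m → j ≤ m → J (s d k j) ≡ k ≤ᵇ count (J ∘ q) j
  counts {zero} _ j≤m = row-zero j≤m
  counts {suc k} {zero} k<m _ = below-diagonal k<m z≤n
  counts {suc k} {suc j} k<m j<m = begin
    J (s d (suc k) (suc j))                         ≡⟨ recurrence k<m j<m ⟩
    J (s d (suc k) j) ∨ J (s d k j) ∧ x (suc j)     ≡⟨ cong₂ (λ a b → a ∨ b ∧ x (suc j))
                                                         (counts k<m (<⇒≤ j<m)) (counts (<⇒≤ k<m) (<⇒≤ j<m)) ⟩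
    suc k ≤ᵇ count x j ∨ k ≤ᵇ count x j ∧ x (suc j) ≡⟨ ≤ᵇ-step k (count x j) (x (suc j)) ⟨
    suc k ≤ᵇ count x (suc j)                        ∎
    where open ≡-Reasoning
          x = J ∘ q

  balanced : Balanced C (J ∘ q) m
  balanced {j} j≤m = 2c≤j+C , j≤2c+C
    where
    c = count (J ∘ q) j
    c≤m = ≤-trans (count≤ (J ∘ q) j) j≤m
    2c≤j+C : 2 * c ≤ j + C
    2c≤j+C with 2 * c ≤? j + C
    ... | yes ok = ok
    ... | no ¬ok = contradiction
      (trans (sym (forced-false c≤m j≤m (≰⇒> ¬ok))) (trans (counts c≤m j≤m) (≤⇒≤ᵇ (≤-refl {c})))) λ ()
    j≤2c+C : j ≤ 2 * c + C
    j≤2c+C with j ≤? 2 * c + C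
    ... | yes ok = ok
    ... | no ¬ok = contradiction
      (≤ᵇ⇒≤ (suc c) c (trans (sym (counts c<m j≤m)) (forced-true c<m 2c+C<j j≤m))) (n≮n c)
      where
      2c+C<j = ≰⇒> ¬ok
      c<m = <-≤-trans (≤-<-trans (≤-trans (m≤m+n c (c + 0)) (m≤m+n (2 * c) C)) 2c+C<j) j≤m

canonicalCounter : ∀ {C d m q J} → (∀ k j → J (s d k j) ≡ k ≤ᵇ count (J ∘ q) j) →
                   Balanced C (J ∘ q) m → SequentialCounter C d m q J
canonicalCounter {C} {d} {m} {q} {J} canon bal = record
  { recurrence     = recurrence
  ; below-diagonal = λ {k} {j} _ j≤k →
                       trans (canon (suc k) j) (>⇒≤ᵇ≡false (s≤s (≤-trans (count≤ x j) j≤k)))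
  ; row-zero       = λ {j} _ → canon 0 j
  ; forced-true    = λ {k} {j} _ 2k+C<j j≤m → trans (canon (suc k) j)
                       (≤⇒≤ᵇ (*-cancelˡ-< 2 k (count x j)
                         (+-cancelʳ-< C _ _ (<-≤-trans 2k+C<j (proj₂ (bal j≤m))))))
  ; forced-false   = λ {k} {j} _ j≤m j+C<2k → trans (canon k j)
                       (>⇒≤ᵇ≡false (*-cancelˡ-< 2 (count x j) k (≤-<-trans (proj₁ (bal j≤m)) j+C<2k)))
  }
  where
  x = J ∘ q
  recurrence : ∀ {k j} → suc k ≤ m → suc j ≤ m →
               J (s d (suc k) (suc j)) ≡ J (s d (suc k) j) ∨ (J (s d k j) ∧ x (suc j))
  recurrence {k} {j} _ _ rewrite canon (suc k) (suc j) | canon (suc k) j | canon k j =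
    ≤ᵇ-step k (count x j) (x (suc j))

SatClause⇔or : ∀ J c → SatClause J c ⇔ (or (map (litVal J) c) ≡ true)
SatClause⇔or J c = mk⇔ (⇒ c) (⇐ c)
  where
  ⇒ : ∀ c → SatClause J c → or (map (litVal J) c) ≡ true
  ⇒ (l ∷ c) (here l-true) rewrite l-true = refl
  ⇒ (l ∷ c) (there sat) rewrite ⇒ c sat = ∨-zeroʳ (litVal J l)
  ⇐ : ∀ c → or (map (litVal J) c) ≡ true → SatClause J c
  ⇐ (l ∷ c) h with litVal J l in l-val
  ... | true  = here l-val
  ... | false = there (⇐ c h)

-- The four clauses of S at (k, j), each read as the disjunction of its literal values.
RecurrenceClauses : Bool → Bool → Bool → Bool → Set
RecurrenceClauses a b c x =
  ((not a ∨ b ∨ c ∨ false) ≡ true) × ((not a ∨ b ∨ x ∨ false) ≡ true) ×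
  ((not b ∨ a ∨ false) ≡ true) × ((not c ∨ not x ∨ a ∨ false) ≡ true)

RecurrenceClauses⇔ : ∀ a b c x → RecurrenceClauses a b c x ⇔ (a ≡ b ∨ (c ∧ x))
RecurrenceClauses⇔ a b c x = mk⇔ (⇒ a b c x) (λ { refl → ⇐ b c x })
  where
  ⇒ : ∀ a b c x → RecurrenceClauses a b c x → a ≡ b ∨ (c ∧ x)
  ⇒ true  true  _     _     _ = refl
  ⇒ true  false true  true  _ = refl
  ⇒ true  false true  false (_ , () , _)
  ⇒ true  false false _     (() , _)
  ⇒ false true  _     _     (_ , _ , () , _)
  ⇒ false false true  true  (_ , _ , _ , ())
  ⇒ false false true  false _ = refl
  ⇒ false false false _     _ = refl
  ⇐ : ∀ b c x → RecurrenceClauses (b ∨ (c ∧ x)) b c x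
  ⇐ true  true  true  = refl , refl , refl , refl
  ⇐ true  true  false = refl , refl , refl , refl
  ⇐ true  false true  = refl , refl , refl , refl
  ⇐ true  false false = refl , refl , refl , refl
  ⇐ false true  true  = refl , refl , refl , refl
  ⇐ false true  false = refl , refl , refl , refl
  ⇐ false false true  = refl , refl , refl , refl
  ⇐ false false false = refl , refl , refl , refl

2[1+k]∸2≡2k : ∀ k → 2 * suc k ∸ 2 ≡ 2 * k
2[1+k]∸2≡2k k = cong (_∸ 2) (*-suc 2 k)

-- The five clause groups that S concatenates, restated here so that they can be named.
module Clauses (C d m : ℕ) (q : ℕ → Var) where

  mainClauses : ℕ → ℕ → CNF
  mainClauses k j =
      (neg (s d k j) ∷ pos (s d k (j ∸ 1)) ∷ pos (s d (k ∸ 1) (j ∸ 1)) ∷ [])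
    ∷ (neg (s d k j) ∷ pos (s d k (j ∸ 1)) ∷ pos (q j) ∷ [])
    ∷ (neg (s d k (j ∸ 1)) ∷ pos (s d k j) ∷ [])
    ∷ (neg (s d (k ∸ 1) (j ∸ 1)) ∷ neg (q j) ∷ pos (s d k j) ∷ [])
    ∷ []

  recurrenceClauses belowDiagonalUnits rowZeroUnits forcedTrueUnits forcedFalseUnits : CNF
  recurrenceClauses  = concatMap (λ k → concatMap (mainClauses k) (range 1 m)) (range 1 m)
  belowDiagonalUnits = concatMap (λ k → map (λ j → [ neg (s d k j) ]) (range 0 (k ∸ 1))) (range 1 m)
  rowZeroUnits       = map (λ j → [ pos (s d 0 j) ]) (range 0 m)
  forcedTrueUnits    = concatMap (λ k → map (λ j → [ pos (s d k j) ]) (range (suc (2 * k ∸ 2 + C)) m))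
                                 (range 1 m)
  forcedFalseUnits   = concatMap (λ k → map (λ j → [ neg (s d k j) ])
                                              (filter (λ j → j <? (2 * k ∸ C)) (range 0 m)))
                                 (range 1 m)

module _ {C d m : ℕ} {q : ℕ → Var} {J : Assignment} where

  open Clauses C d m q

  private
    or-val = λ c → to (SatClause⇔or J c)
    or-sat = λ c → from (SatClause⇔or J c)

  S⇒SequentialCounter : SatCNF J (S C d m q) → SequentialCounter C d m q J
  S⇒SequentialCounter sat = record
    { recurrence     = recurrence
    ; below-diagonal = λ {k} {j} k<m j≤k → unit-false (All-range⁻ 0 k
                         (AllP.map⁻ (All-concatMap-range⁻ 1 m group₂ (suc k) (s≤s z≤n) k<m)) j z≤n j≤k)
    ; row-zero       = λ {j} j≤m → AnyP.singleton⁻ (All-range⁻ 0 m (AllP.map⁻ group₃) j z≤n j≤m)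
    ; forced-true    = λ {k} {j} k<m 2k+C<j j≤m → AnyP.singleton⁻ (All-range⁻ (suc (2 * suc k ∸ 2 + C)) m
                         (AllP.map⁻ (All-concatMap-range⁻ 1 m group₄ (suc k) (s≤s z≤n) k<m)) j
                         (subst (λ t → suc (t + C) ≤ j) (sym (2[1+k]∸2≡2k k)) 2k+C<j) j≤m)
    ; forced-false   = λ { {zero} _ _ ()
                         ; {suc k} {j} k≤m j≤m j+C<2k → unit-false (All-range⁻ 0 m
                             (to (All-filter⇔ (λ j → j <? 2 * suc k ∸ C) (range 0 m))
                                 (AllP.map⁻ (All-concatMap-range⁻ 1 m group₅ (suc k) (s≤s z≤n) k≤m)))
                             j z≤n j≤m (m+n≤o⇒m≤o∸n (suc j) j+C<2k)) }
    }
    where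
    group₁ = AllP.++⁻ˡ recurrenceClauses sat
    rest₁  = AllP.++⁻ʳ recurrenceClauses sat
    group₂ = AllP.++⁻ˡ belowDiagonalUnits rest₁
    rest₂  = AllP.++⁻ʳ belowDiagonalUnits rest₁
    group₃ = AllP.++⁻ˡ rowZeroUnits rest₂
    rest₃  = AllP.++⁻ʳ rowZeroUnits rest₂
    group₄ = AllP.++⁻ˡ forcedTrueUnits rest₃
    group₅ = AllP.++⁻ʳ forcedTrueUnits rest₃

    recurrence : ∀ {k j} → suc k ≤ m → suc j ≤ m →
                 J (s d (suc k) (suc j)) ≡ J (s d (suc k) j) ∨ (J (s d k j) ∧ J (q (suc j)))
    recurrence {k} {j} k<m j<m with All-concatMap-range⁻ 1 m
      (All-concatMap-range⁻ 1 m group₁ (suc k) (s≤s z≤n) k<m) (suc j) (s≤s z≤n) j<m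
    ... | c₁ ∷ c₂ ∷ c₃ ∷ c₄ ∷ [] =
      to (RecurrenceClauses⇔ (J (s d (suc k) (suc j))) (J (s d (suc k) j)) (J (s d k j)) (J (q (suc j))))
         (or-val _ c₁ , or-val _ c₂ , or-val _ c₃ , or-val _ c₄)

    unit-false : ∀ {v} → SatClause J [ neg v ] → J v ≡ false
    unit-false u = not-injective (AnyP.singleton⁻ u)

  SequentialCounter⇒S : SequentialCounter C d m q J → SatCNF J (S C d m q)
  SequentialCounter⇒S sc =
    AllP.++⁺ group₁ (AllP.++⁺ group₂ (AllP.++⁺ group₃ (AllP.++⁺ group₄ group₅)))
    where
    open SequentialCounter sc
    group₁ : SatCNF J recurrenceClauses
    group₁ = All-concatMap-range⁺ 1 m λ { zero () _ ; (suc k) _ k<m →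
             All-concatMap-range⁺ 1 m λ { zero () _ ; (suc j) _ j<m →
      let c₁ , c₂ , c₃ , c₄ = from (RecurrenceClauses⇔ (J (s d (suc k) (suc j))) (J (s d (suc k) j))
                                                         (J (s d k j)) (J (q (suc j))))
                                   (recurrence k<m j<m)
      in or-sat _ c₁ ∷ or-sat _ c₂ ∷ or-sat _ c₃ ∷ or-sat _ c₄ ∷ [] } }
    group₂ : SatCNF J belowDiagonalUnits
    group₂ = All-concatMap-range⁺ 1 m λ { zero () _ ; (suc k) _ k<m →
      AllP.map⁺ (All-range⁺ 0 k λ j _ j≤k → here (cong not (below-diagonal k<m j≤k))) }
    group₃ : SatCNF J rowZeroUnits
    group₃ = AllP.map⁺ (All-range⁺ 0 m λ j _ j≤m → here (row-zero j≤m))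
    group₄ : SatCNF J forcedTrueUnits
    group₄ = All-concatMap-range⁺ 1 m λ { zero () _ ; (suc k) _ k<m →
      AllP.map⁺ (All-range⁺ (suc (2 * suc k ∸ 2 + C)) m λ j lo j≤m →
        here (forced-true k<m (subst (λ t → suc (t + C) ≤ j) (2[1+k]∸2≡2k k) lo) j≤m)) }
    group₅ : SatCNF J forcedFalseUnits
    group₅ = All-concatMap-range⁺ 1 m λ k _ k≤m →
      AllP.map⁺ (from (All-filter⇔ (λ j → j <? 2 * k ∸ C) (range 0 m))
        (All-range⁺ 0 m λ j _ j≤m j<2k∸C →
        here (cong not (forced-false k≤m j≤m (m<n∸o⇒m+o<n j (2 * k) C j<2k∸C)))))

canonical : (ℕ → Bool) → Assignment
canonical I (p i) = I i
canonical I (s d k j) = k ≤ᵇ count (I ∘ (_* d)) j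

canonical-satisfies-S : ∀ {C} I d {m} → Balanced C (I ∘ (_* d)) m →
                        SatCNF (canonical I) (S C d m (λ j → p (j * d)))
canonical-satisfies-S I d bal = SequentialCounter⇒S (canonicalCounter (λ _ _ → refl) bal)

alternating : Bool → ℕ → Bool
alternating b zero = b
alternating b (suc i) = alternating (not b) i

alternating-not : ∀ b i → alternating (not b) i ≡ not (alternating b i)
alternating-not b zero = refl
alternating-not b (suc i) = begin
  alternating (not (not b)) i ≡⟨ cong (λ b′ → alternating b′ i) (not-involutive b) ⟩
  alternating b i             ≡⟨ not-involutive (alternating b i) ⟨
  not (not (alternating b i)) ≡⟨ cong not (alternating-not b i) ⟨
  not (alternating (not b) i) ∎
  where open ≡-Reasoning

alternating-involutive : ∀ b i → alternating (alternating b i) i ≡ b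
alternating-involutive b zero = refl
alternating-involutive b (suc i) = begin
  alternating (not (alternating (not b) i)) i ≡⟨ cong (λ b′ → alternating (not b′) i)
                                                       (alternating-not b i) ⟩
  alternating (not (not (alternating b i))) i ≡⟨ cong (λ b′ → alternating b′ i) (not-involutive _) ⟩
  alternating (alternating b i) i             ≡⟨ alternating-involutive b i ⟩
  b                                           ∎
  where open ≡-Reasoning

count-alternating : ∀ b j → count (alternating b) (suc (suc j)) ≡ suc (count (alternating b) j)
count-alternating b j rewrite alternating-not b (suc j) with alternating b (suc j)
... | true  = refl
... | false = refl

alternating-balanced : ∀ b j → Within 1 (2 * count (alternating b) j) j
alternating-balanced b zero = z≤n , z≤n
alternating-balanced b (suc zero) with alternating b 1
... | true  = s≤s (s≤s z≤n) , s≤s z≤n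
... | false = z≤n , s≤s z≤n
alternating-balanced b (suc (suc j)) = subst (λ t → Within 1 t (suc (suc j)))
  (trans (sym (*-suc 2 c)) (cong (2 *_) (sym (count-alternating b j))))
  (to Within-suc (to Within-suc (alternating-balanced b j)))
  where c = count (alternating b) j

-- Along the progression d, 2d, … the assignment alternates (so C ≥ 1 suffices), and p i gets value b.
S-inputsUnconstrained : ∀ {C} → 1 ≤ C → ∀ e m →
                        InputsUnconstrained (S C (suc e) m (λ j → p (j * suc e)))
S-inputsUnconstrained {C} 1≤C e m i b =
  canonical g , canonical-satisfies-S g (suc e) balanced , alternating-involutive b (i / suc e)
  where
  g : ℕ → Bool
  g i′ = alternating (alternating b (i / suc e)) (i′ / suc e)
  balanced : Balanced C (g ∘ (_* suc e)) m
  balanced {j} _ = subst (λ c → Within C (2 * c) j)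
    (count-cong j λ {i′} _ _ → cong (alternating _) (sym (m*n/n≡m i′ (suc e))))
    (Within-mono 1≤C (alternating-balanced _ j))

m*n≤o⇒m≤o/n : ∀ m n {o} .{{_ : NonZero n}} → m * n ≤ o → m ≤ o / n
m*n≤o⇒m≤o/n m n {o} h = subst (_≤ o / n) (m*n/n≡m m n) (/-monoˡ-≤ n h)

m≤o/n⇒m*n≤o : ∀ {m} n {o} .{{_ : NonZero n}} → m ≤ o / n → m * n ≤ o
m≤o/n⇒m*n≤o n {o} h = ≤-trans (*-monoˡ-≤ n h) (m/n*n≤m o n)

EDP⇔ : ∀ {J} C n → SatCNF J (EDP C n) ⇔
       (∀ e → suc e ≤ n / suc C → SatCNF J (CBound C (suc e) (n / suc e) (λ j → p (j * suc e))))
EDP⇔ C n = mk⇔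
  (λ sat e 1+e≤ → All-concatMap-range⁻ 1 (n / suc C) sat (suc e) (s≤s z≤n) 1+e≤)
  (λ sat → All-concatMap-range⁺ 1 (n / suc C) λ { zero () _ ; (suc e) _ 1+e≤ → sat e 1+e≤ })

discrepancy⇒balanced : ∀ {n I C} → DiscrepancyAtMost n I C →
                       ∀ e → Balanced C (I ∘ (_* suc e)) (n / suc e)
discrepancy⇒balanced disc e {zero} _ = z≤n , z≤n
discrepancy⇒balanced {I = I} disc e {suc j} j≤m = to (∣partialSum∣≤⇔Within I (suc e) (suc j))
  (disc (suc e) (suc j) (s≤s z≤n) (s≤s z≤n) (m≤o/n⇒m*n≤o (suc e) j≤m))

discrepancy⇒EDP : ∀ {C n I} → DiscrepancyAtMost n I C → SatCNF (canonical I) (EDP C n)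
discrepancy⇒EDP {C} {n} {I} disc = from (EDP⇔ C n) λ e _ →
  let φ = S C (suc e) (n / suc e) (λ j → p (j * suc e))
  in propagateFuel-sound (length φ) φ (canonical-satisfies-S I (suc e) (discrepancy⇒balanced disc e))

CBound⇒balanced : ∀ {C J} → 1 ≤ C → ∀ e m → SatCNF J (CBound C (suc e) m (λ j → p (j * suc e))) →
                  Balanced C (J ∘ (λ j → p (j * suc e))) m
CBound⇒balanced {C} 1≤C e m sat {j} j≤m
  with propagateFuel-complete (length φ) φ (S-inputsUnconstrained 1≤C e m) sat
  where φ = S C (suc e) m (λ j → p (j * suc e))
... | J′ , sat′ , agree = subst (λ c → Within C (2 * c) j) (count-cong j λ _ _ → agree _)
  (SequentialCounter.balanced (S⇒SequentialCounter sat′) j≤m)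

EDP⇒discrepancy : ∀ {C n I I′} → 1 ≤ C → (∀ i → 1 ≤ i → i ≤ n → I′ (p i) ≡ I i) →
                  SatCNF I′ (EDP C n) → DiscrepancyAtMost n I C
EDP⇒discrepancy {C} {n} {I} {I′} 1≤C agree sat (suc e) k _ _ kd≤n =
  from (∣partialSum∣≤⇔Within I (suc e) k) (subst (λ c → Within C (2 * c) k) (count-cong k agree≤k) within)
  where
  agree≤k : ∀ {i} → 1 ≤ i → i ≤ k → I′ (p (i * suc e)) ≡ I (i * suc e)
  agree≤k {suc i} _ i≤k = agree _ (s≤s z≤n) (≤-trans (*-monoˡ-≤ (suc e) i≤k) kd≤n)
  within : Within C (2 * count (I′ ∘ (λ j → p (j * suc e))) k) k
  within with suc e ≤? n / suc C
  ... | yes d≤n/[1+C] =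
    CBound⇒balanced 1≤C e _ (to (EDP⇔ C n) sat e d≤n/[1+C]) (m*n≤o⇒m≤o/n k (suc e) kd≤n)
  ... | no d≰n/[1+C] = short-prefix-within _ (≮⇒≥ λ C<k → d≰n/[1+C] (m*n≤o⇒m≤o/n (suc e) (suc C)
    (≤-trans (≤-reflexive (*-comm (suc e) (suc C))) (≤-trans (*-monoˡ-≤ (suc e) C<k) kd≤n))))

theorem2 : (C n : ℕ) → 1 ≤ C → 1 ≤ n → (I : ℕ → Bool) →
    (Σ Assignment (λ I′ → ((i : ℕ) → 1 ≤ i → i ≤ n → I′ (p i) ≡ I i) × SatCNF I′ (EDP C n)))
      ⇔ DiscrepancyAtMost n I C
theorem2 C n 1≤C _ I = mk⇔
  (λ (I′ , agree , sat) → EDP⇒discrepancy 1≤C agree sat)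
  (λ disc → canonical I , (λ _ _ _ → refl) , discrepancy⇒EDP disc)
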